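{- For all positive integers $n \ge d \ge 2$ there exists a collection $\mathcal{A} \subset \mathcal{P}([n]^d)$ with $|\mathcal{A}| = |\mathcal{P}([n]^d)|/2$ such that there is no pair $(A,B) \in \mathcal{A} \times \mathcal{A}$ satisfying $A \,\Delta\, B = S^d$ for some non-empty subset $S \subset [n]$ that can be written as a union of at most $\lfloor d/2 \rfloor$ intervals.
   Context: $[n]=\{1,\dots,n\}$; for integers $a \le b$, $[a,b]=\{a,a+1,\dots,b\}$ is called an interval. $\mathcal{P}(X)$ denotes the power set of $X$, $A\,\Delta\, B$ the symmetric difference, and $S^d = S\times\dots\times S \subset [n]^d$ ($d$ factors). -}

module Defs where

open import Data.Nat using (ℕ; _≤_; _/_)
open import Data.Fin using (Fin)
open import Data.Fin.Base as F using ()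
open import Data.Bool using (Bool; true; false; _xor_)
open import Data.Vec using (Vec)
open import Data.Vec.Relation.Unary.All using (All)
open import Data.List using (List; length)
open import Data.List.Relation.Unary.Any using (Any)
open import Data.List.Relation.Unary.AllPairs using (AllPairs)
open import Data.Product using (_×_; ∃; Σ)
open import Relation.Binary.PropositionalEquality using (_≡_)
open import Relation.Nullary using (¬_)
open import Function.Bundles using (_⇔_)

Point : ℕ → ℕ → Set
Point n d = Vec (Fin n) d

GridSet : ℕ → ℕ → Set
GridSet n d = Point n d → Bool

LineSet : ℕ → Set
LineSet n = Fin n → Bool

_≐_ : ∀ {n d} → GridSet n d → GridSet n d → Set
A ≐ B = ∀ x → A x ≡ B x

_Δ_ : ∀ {n d} → GridSet n d → GridSet n d → GridSet n d
(A Δ B) x = A x xor B x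

SymDiffIsCube : ∀ {n d} → GridSet n d → GridSet n d → LineSet n → Set
SymDiffIsCube A B S = ∀ x → ((A Δ B) x ≡ true) ⇔ All (λ i → S i ≡ true) x

record Interval (n : ℕ) : Set where
  constructor interval
  field
    lo hi  : Fin n
    lo≤hi  : lo F.≤ hi

_∈I_ : ∀ {n} → Fin n → Interval n → Set
i ∈I I = (Interval.lo I F.≤ i) × (i F.≤ Interval.hi I)

IsUnionOf : ∀ {n} → LineSet n → List (Interval n) → Set
IsUnionOf S Is = ∀ i → (S i ≡ true) ⇔ Any (i ∈I_) Is

NonEmpty : ∀ {n} → LineSet n → Set
NonEmpty S = ∃ λ i → S i ≡ true

UnionOfAtMost : ∀ {n} → ℕ → LineSet n → Set
UnionOfAtMost k S = Σ (List _) λ Is → (length Is ≤ k) × IsUnionOf S Is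

-- A collection of subsets of [n]^d, given as a duplicate-free list.
DistinctList : ∀ {n d} → List (GridSet n d) → Set
DistinctList = AllPairs (λ A B → ¬ (A ≐ B))

module Submission where

-- Let k = ⌊d/2⌋. A nonempty S ⊆ [n] that is a union of at most k intervals has between 1 and k
-- run ends a (a ∈ S, a + 1 ∉ S), and "a is a run end" is the GF(2)-polynomial rₐ = xₐ + xₐxₐ₊₁
-- in the indicator vector x of S. If at most k of the rₐ are 1, then e₁(r) + ⋯ + eₖ(r) is 1 iff
-- some rₐ is, so this polynomial of degree ≤ 2k ≤ d equals 1 on every such S. Every monomial of
-- degree ≤ d is the indicator of S^d evaluated at a point of [n]^d, so the polynomial is Φ(S^d)
-- for a GF(2)-linear functional Φ on 𝒫([n]^d) with Φ([n]^d) = 1. Its kernel 𝒜 is half of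
-- 𝒫([n]^d), and A Δ B = S^d is impossible in it since Φ(A Δ B) = Φ A + Φ B = 0.

open import Defs
open import Algebra.Bundles using (CommutativeRing)
open import Data.Bool using (Bool; true; false; _xor_; _∧_; not; if_then_else_)
open import Data.Bool.ListAction using (all)
open import Data.Bool.Properties
  using ( T-≡; not-injective; not-¬; xor-comm; xor-assoc; xor-identityʳ; ∧-assoc; ∧-zeroʳ
        ; ∧-conicalˡ; ∧-conicalʳ; ∧-distribˡ-xor; ∧-distribʳ-xor; xor-∧-commutativeRing)
open import Algebra.Properties.CommutativeSemigroup
  (CommutativeRing.+-commutativeSemigroup xor-∧-commutativeRing) using (interchange)
open import Data.Fin using (Fin; zero; suc; toℕ; inject₁; fromℕ)
open import Data.Fin.Induction using (>-weakInduction)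
import Data.Fin.Properties as Fin
open import Data.Fin.Subset using (Subset; ∣_∣; _∪_; ⋃; ⁅_⁆; _⊆_) renaming (_∈_ to _∈ₛ_)
open import Data.Fin.Subset.Properties
  using (∣p∣≤∣x∷p∣; ∣⊥∣≡0; ∣⁅x⁆∣≡1; p⊆p∪q; q⊆p∪q; x∈⁅x⁆; p⊆q⇒∣p∣≤∣q∣; x∈p⇒∣p-x∣<∣p∣)
open import Data.List using (List; []; _∷_; _++_; map; length; allFin; cartesianProductWith)
open import Data.List.Membership.Propositional using (_∈_; find; lose)
open import Data.List.Membership.Propositional.Properties using (∈-map⁺)
open import Data.List.NonEmpty as List⁺ using (List⁺; _∷_; _⁺++⁺_)
open import Data.List.NonEmpty.Properties using (length-⁺++⁺)
open import Data.List.Properties using (length-map; length-++; length-tabulate)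
open import Data.List.Relation.Unary.All as All using (All; []; _∷_)
import Data.List.Relation.Unary.All.Properties as All
open import Data.List.Relation.Unary.AllPairs as AllPairs using (AllPairs; []; _∷_)
import Data.List.Relation.Unary.AllPairs.Properties as AllPairs
open import Data.List.Relation.Unary.Any using (here; there)
open import Data.List.Relation.Unary.Unique.Propositional using (Unique)
import Data.List.Relation.Unary.Unique.Propositional.Properties as Unique
open import Data.Maybe as Maybe using (Maybe; just; nothing; maybe′)
open import Data.Nat using (ℕ; zero; suc; _≤_; _<_; _<ᵇ_; _^_; _∸_; _/_; _+_; _*_; z≤n; s≤s)
open import Data.Nat.DivMod using (m/n*n≤m; /-monoˡ-≤)
import Data.Nat.Properties as ℕ
open import Data.Product using (Σ; ∃; _×_; _,_)
open import Data.Vec as Vec using (Vec; []; _∷_)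
import Data.Vec.Properties as Vec
open import Data.Vec.Properties
  using (∷-injective; tabulate-∘; tabulate-cong; lookup∘tabulate; lookup⇒[]=; []=⇒lookup)
open import Data.Vec.Relation.Unary.All as VAll using () renaming ([] to []ᵛ; _∷_ to _∷ᵛ_)
open import Data.Vec.Relation.Unary.All.Properties using (tabulate⁺)
open import Function using (_∘_; id)
open import Function.Bundles using (_⇔_; mk⇔; Equivalence)
import Function.Properties.Equivalence as ⇔
open import Relation.Binary.Definitions using (DecidableEquality)
open import Relation.Binary.PropositionalEquality
open import Relation.Nullary using (¬_; yes; no; does; contradiction)

open Equivalence using (to; from)

false≢true : false ≢ true
false≢true ()

xor-true : ∀ b → b xor true ≡ not b
xor-true b = xor-comm b true

xor-true≢id : ∀ b → b xor true ≢ b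
xor-true≢id b eq = not-¬ refl (sym (trans (sym (xor-true b)) eq))

≡true⇔⇒≡ : ∀ {x y} → (x ≡ true ⇔ y ≡ true) → x ≡ y
≡true⇔⇒≡ {true}          x⇔y = sym (to x⇔y refl)
≡true⇔⇒≡ {false} {true}  x⇔y = from x⇔y refl
≡true⇔⇒≡ {false} {false} _   = refl

parity : {A : Set} → List A → (A → Bool) → Bool
parity []       f = false
parity (x ∷ xs) f = f x xor parity xs f

module _ {A : Set} where

  parity-++ : ∀ (xs ys : List A) f → parity (xs ++ ys) f ≡ parity xs f xor parity ys f
  parity-++ []       ys f = refl
  parity-++ (x ∷ xs) ys f rewrite parity-++ xs ys f = sym (xor-assoc (f x) (parity xs f) (parity ys f))

  parity-xor : ∀ (xs : List A) f g → parity xs (λ x → f x xor g x) ≡ parity xs f xor parity xs g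
  parity-xor []       f g = refl
  parity-xor (x ∷ xs) f g rewrite parity-xor xs f g = interchange (f x) (g x) (parity xs f) (parity xs g)

  parity-cong : ∀ {xs : List A} {f g} → All (λ x → f x ≡ g x) xs → parity xs f ≡ parity xs g
  parity-cong []           = refl
  parity-cong (fx≡gx ∷ eqs) = cong₂ _xor_ fx≡gx (parity-cong eqs)

all-++ : ∀ {A : Set} (p : A → Bool) xs ys → all p (xs ++ ys) ≡ all p xs ∧ all p ys
all-++ p []       ys = refl
all-++ p (x ∷ xs) ys rewrite all-++ p xs ys = sym (∧-assoc (p x) (all p xs) (all p ys))

-- Polynomials over GF(2)

-- A polynomial over GF(2) in x₁, …, xₙ is the list of its monomials, read as their sum.
Monomial : ℕ → Set
Monomial n = List⁺ (Fin n)

Poly : ℕ → Set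
Poly n = List (Monomial n)

_·_ : ∀ {n} → Poly n → Poly n → Poly n
P · Q = cartesianProductWith _⁺++⁺_ P Q

Degree≤ : ∀ {n} → ℕ → Poly n → Set
Degree≤ e = All (λ m → List⁺.length m ≤ e)

module _ {n : ℕ} (S : LineSet n) where

  evalMon : Monomial n → Bool
  evalMon m = all S (List⁺.toList m)

  eval : Poly n → Bool
  eval P = parity P evalMon

  evalMon-⁺++⁺ : ∀ m m′ → evalMon (m ⁺++⁺ m′) ≡ evalMon m ∧ evalMon m′
  evalMon-⁺++⁺ m m′ = all-++ S (List⁺.toList m) (List⁺.toList m′)

  eval-++ : ∀ P Q → eval (P ++ Q) ≡ eval P xor eval Q
  eval-++ P Q = parity-++ P Q evalMon

  eval-map : ∀ m Q → eval (map (m ⁺++⁺_) Q) ≡ evalMon m ∧ eval Q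
  eval-map m []      = sym (∧-zeroʳ (evalMon m))
  eval-map m (m′ ∷ Q) rewrite eval-map m Q | evalMon-⁺++⁺ m m′ =
    sym (∧-distribˡ-xor (evalMon m) (evalMon m′) (eval Q))

  eval-· : ∀ P Q → eval (P · Q) ≡ eval P ∧ eval Q
  eval-· []      Q = refl
  eval-· (m ∷ P) Q = begin
    eval (map (m ⁺++⁺_) Q ++ P · Q)             ≡⟨ eval-++ (map (m ⁺++⁺_) Q) (P · Q) ⟩
    eval (map (m ⁺++⁺_) Q) xor eval (P · Q)     ≡⟨ cong₂ _xor_ (eval-map m Q) (eval-· P Q) ⟩
    (evalMon m ∧ eval Q) xor (eval P ∧ eval Q)  ≡⟨ ∧-distribʳ-xor (eval Q) (evalMon m) (eval P) ⟨
    (evalMon m xor eval P) ∧ eval Q             ∎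
    where open ≡-Reasoning

-- σ≤ k xs = e₁(xs) + ⋯ + eₖ(xs), the elementary symmetric polynomials of degree 1 to k,
-- via eⱼ(x ∷ xs) = eⱼ(xs) + x eⱼ₋₁(xs) and e₀ = 1.
σ≤ : ∀ {A : Set} {m} → (A → A → A) → (A → A → A) → A → ℕ → Vec A m → A
σ≤ _+_ _*_ 0# zero    xs       = 0#
σ≤ _+_ _*_ 0# (suc k) []       = 0#
σ≤ _+_ _*_ 0# (suc k) (x ∷ xs) = σ≤ _+_ _*_ 0# (suc k) xs + (x + (x * σ≤ _+_ _*_ 0# k xs))

σ≤-homomorphic : ∀ {A B : Set} {_+_ _*_ : A → A → A} {0# : A} {_⊕_ _⊗_ : B → B → B} {0′ : B}
  (f : A → B) → f 0# ≡ 0′ → (∀ x y → f (x + y) ≡ f x ⊕ f y) → (∀ x y → f (x * y) ≡ f x ⊗ f y) →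
  ∀ {m} k (xs : Vec A m) → f (σ≤ _+_ _*_ 0# k xs) ≡ σ≤ _⊕_ _⊗_ 0′ k (Vec.map f xs)
σ≤-homomorphic f f0 f+ f* zero    xs       = f0
σ≤-homomorphic f f0 f+ f* (suc k) []       = f0
σ≤-homomorphic {_+_ = _+_} {_*_} {0#} {_⊕_} {_⊗_} f f0 f+ f* (suc k) (x ∷ xs) = begin
  f (σ≤ _+_ _*_ 0# (suc k) xs + (x + (x * σ≤ _+_ _*_ 0# k xs)))
    ≡⟨ f+ _ _ ⟩
  f (σ≤ _+_ _*_ 0# (suc k) xs) ⊕ f (x + (x * σ≤ _+_ _*_ 0# k xs))
    ≡⟨ cong₂ _⊕_ (σ≤-homomorphic f f0 f+ f* (suc k) xs) (trans (f+ _ _) (cong (f x ⊕_) (f* _ _))) ⟩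
  (σ≤ _⊕_ _⊗_ _ (suc k) (Vec.map f xs) ⊕ (f x ⊕ (f x ⊗ f (σ≤ _+_ _*_ 0# k xs))))
    ≡⟨ cong (λ y → σ≤ _⊕_ _⊗_ _ (suc k) (Vec.map f xs) ⊕ (f x ⊕ (f x ⊗ y)))
            (σ≤-homomorphic f f0 f+ f* k xs) ⟩
  σ≤ _⊕_ _⊗_ _ (suc k) (f x ∷ Vec.map f xs) ∎
  where open ≡-Reasoning

σᴮ : ∀ {m} → ℕ → Vec Bool m → Bool
σᴮ = σ≤ _xor_ _∧_ false

-- Once at most k of the xᵢ are 1, e₁ + ⋯ + eₖ = ∑_{∅ ≠ T} ∏_{i ∈ T} xᵢ = 1 − ∏ (1 − xᵢ).
σᴮ-indicator : ∀ {m} k (v : Subset m) → ∣ v ∣ ≤ k → σᴮ k v ≡ (0 <ᵇ ∣ v ∣)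
σᴮ-indicator zero    v       ∣v∣≤0 rewrite ℕ.n≤0⇒n≡0 ∣v∣≤0 = refl
σᴮ-indicator (suc k) []      _     = refl
σᴮ-indicator (suc k) (false ∷ v) ∣v∣≤k
  rewrite σᴮ-indicator (suc k) v ∣v∣≤k = xor-identityʳ (0 <ᵇ ∣ v ∣)
σᴮ-indicator (suc k) (true ∷ v) (s≤s ∣v∣≤k)
  rewrite σᴮ-indicator (suc k) v (ℕ.m≤n⇒m≤1+n ∣v∣≤k) | σᴮ-indicator k v ∣v∣≤k = b-xor-not-b (0 <ᵇ ∣ v ∣)
  where
  b-xor-not-b : ∀ b → b xor (true xor (true ∧ b)) ≡ true
  b-xor-not-b false = refl
  b-xor-not-b true  = refl

σ≤-degree : ∀ {n m} e k (ps : Vec (Poly n) m) → VAll.All (Degree≤ e) ps →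
            Degree≤ (k * e) (σ≤ _++_ _·_ [] k ps)
σ≤-degree e zero    ps       _          = []
σ≤-degree e (suc k) []       _          = []
σ≤-degree e (suc k) (p ∷ ps) (dp ∷ᵛ dps) =
  All.++⁺ (σ≤-degree e (suc k) ps dps)
    (All.++⁺ (All.map (λ l≤e → ℕ.≤-trans l≤e (ℕ.m≤m+n e (k * e))) dp)
             (All.cartesianProductWith⁺ (setoid _) (setoid _) _⁺++⁺_ p (σ≤ _++_ _·_ [] k ps)
               (λ {m} {m′} m∈p m′∈σ → subst (_≤ e + k * e) (sym (length-⁺++⁺ m m′))
                  (ℕ.+-mono-≤ (All.lookup dp m∈p) (All.lookup (σ≤-degree e k ps dps) m′∈σ)))))

-- Run ends

next : ∀ {n} → Fin n → Maybe (Fin n)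
next {suc zero}    zero    = nothing
next {suc (suc n)} zero    = just (suc zero)
next {suc (suc n)} (suc i) = Maybe.map suc (next i)

next-just : ∀ {n} {a b : Fin n} → next a ≡ just b → toℕ b ≡ suc (toℕ a)
next-just {suc (suc n)} {zero}  refl = refl
next-just {suc (suc n)} {suc i} eq with next i in eqᵢ
next-just {suc (suc n)} {suc i} refl | just c = cong suc (next-just eqᵢ)

next-nothing : ∀ {n} {a : Fin n} → next a ≡ nothing → ∀ (c : Fin n) → toℕ c ≤ toℕ a
next-nothing {suc zero}    {zero}  _  zero    = z≤n
next-nothing {suc (suc n)} {suc i} _  zero    = z≤n
next-nothing {suc (suc n)} {suc i} eq (suc c) with next i in eqᵢ
next-nothing {suc (suc n)} {suc i} refl (suc c) | nothing = s≤s (next-nothing eqᵢ c)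

next-inject₁ : ∀ {n} (i : Fin n) → next (inject₁ i) ≡ just (suc i)
next-inject₁ {suc zero}    zero    = refl
next-inject₁ {suc (suc n)} zero    = refl
next-inject₁ {suc (suc n)} (suc i) = cong (Maybe.map suc) (next-inject₁ i)

next-fromℕ : ∀ n → next (fromℕ n) ≡ nothing
next-fromℕ zero    = refl
next-fromℕ (suc n) = cong (Maybe.map suc) (next-fromℕ n)

runEnd : ∀ {n} → LineSet n → Fin n → Bool
runEnd S a = S a ∧ not (maybe′ S false (next a))

runEnd-exists : ∀ {n} (S : LineSet n) a → S a ≡ true → ∃ λ b → runEnd S b ≡ true
runEnd-exists {suc m} S = >-weakInduction P last step
  where
  P : Fin (suc m) → Set
  P a = S a ≡ true → ∃ λ b → runEnd S b ≡ true
  last : P (fromℕ m)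
  last Sa = fromℕ m , cong₂ (λ x y → x ∧ not (maybe′ S false y)) Sa (next-fromℕ m)
  step : ∀ i → P (suc i) → P (inject₁ i)
  step i ih Sa with S (suc i) in S[i+1]
  ... | true  = ih refl
  ... | false = inject₁ i ,
    cong₂ (λ x y → x ∧ not y) Sa (trans (cong (maybe′ S false) (next-inject₁ i)) S[i+1])

-- xₐ + xₐxₐ₊₁, or just xₐ when a is the last element of [n].
runEndPoly : ∀ {n} → Fin n → Poly n
runEndPoly a = (a ∷ []) ∷ maybe′ (λ b → (a ∷ b ∷ []) ∷ []) [] (next a)

runEndPoly-degree : ∀ {n} (a : Fin n) → Degree≤ 2 (runEndPoly a)
runEndPoly-degree a with next a
... | just b  = s≤s z≤n ∷ ℕ.≤-refl ∷ []
... | nothing = s≤s z≤n ∷ []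

eval-runEndPoly : ∀ {n} (S : LineSet n) a → eval S (runEndPoly a) ≡ runEnd S a
eval-runEndPoly S a with next a
... | just b  = x∧¬y (S a) (S b)
  where
  x∧¬y : ∀ x y → (x ∧ true) xor ((x ∧ (y ∧ true)) xor false) ≡ x ∧ not y
  x∧¬y false y     = refl
  x∧¬y true  false = refl
  x∧¬y true  true  = refl
... | nothing = xor-identityʳ (S a ∧ true)

module _ {n : ℕ} (S : LineSet n) where

  runEnd⇒∈ : ∀ {a} → runEnd S a ≡ true → S a ≡ true
  runEnd⇒∈ {a} = ∧-conicalˡ (S a) _

  runEnd-is-hi : ∀ {a} (I : Interval n) → (∀ b → b ∈I I → S b ≡ true) →
                 runEnd S a ≡ true → a ∈I I → a ≡ Interval.hi I
  runEnd-is-hi {a} (interval lo hi _) I⊆S end (lo≤a , a≤hi) =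
    Fin.toℕ-injective (ℕ.≤-antisym a≤hi hi≤a)
    where
    hi≤a : toℕ hi ≤ toℕ a
    hi≤a with next a in next-a
    ... | nothing = next-nothing next-a hi
    ... | just b with toℕ hi ℕ.≤? toℕ a
    ...   | yes hi≤a = hi≤a
    ...   | no  hi≰a =
      contradiction (trans (cong not (sym (I⊆S b (lo≤b , b≤hi)))) (∧-conicalʳ (S a) _ end)) false≢true
      where
      b≡a+1 : toℕ b ≡ suc (toℕ a)
      b≡a+1 = next-just next-a
      lo≤b : toℕ lo ≤ toℕ b
      lo≤b = subst (toℕ lo ≤_) (sym b≡a+1) (ℕ.m≤n⇒m≤1+n lo≤a)
      b≤hi : toℕ b ≤ toℕ hi
      b≤hi = subst (_≤ toℕ hi) (sym b≡a+1) (ℕ.≰⇒> hi≰a)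

  runEnd∈map-hi : ∀ {a} Is → IsUnionOf S Is → runEnd S a ≡ true → a ∈ map Interval.hi Is
  runEnd∈map-hi {a} Is S≡⋃Is end with I , I∈Is , a∈I ← find (to (S≡⋃Is a) (runEnd⇒∈ end)) =
    subst (_∈ map Interval.hi Is) (sym (runEnd-is-hi I I⊆S end a∈I)) (∈-map⁺ Interval.hi I∈Is)
    where
    I⊆S : ∀ b → b ∈I I → S b ≡ true
    I⊆S b b∈I = from (S≡⋃Is b) (lose I∈Is b∈I)

∣p∪q∣≤∣p∣+∣q∣ : ∀ {n} (p q : Subset n) → ∣ p ∪ q ∣ ≤ ∣ p ∣ + ∣ q ∣
∣p∪q∣≤∣p∣+∣q∣ []          []          = z≤n
∣p∪q∣≤∣p∣+∣q∣ (true  ∷ p) (x     ∷ q) =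
  s≤s (ℕ.≤-trans (∣p∪q∣≤∣p∣+∣q∣ p q) (ℕ.+-monoʳ-≤ ∣ p ∣ (∣p∣≤∣x∷p∣ x q)))
∣p∪q∣≤∣p∣+∣q∣ (false ∷ p) (true  ∷ q) =
  ℕ.≤-trans (s≤s (∣p∪q∣≤∣p∣+∣q∣ p q)) (ℕ.≤-reflexive (sym (ℕ.+-suc ∣ p ∣ ∣ q ∣)))
∣p∪q∣≤∣p∣+∣q∣ (false ∷ p) (false ∷ q) = ∣p∪q∣≤∣p∣+∣q∣ p q

∣⋃⁅xs⁆∣≤length : ∀ {n} (xs : List (Fin n)) → ∣ ⋃ (map ⁅_⁆ xs) ∣ ≤ length xs
∣⋃⁅xs⁆∣≤length {n} []       = ℕ.≤-reflexive (∣⊥∣≡0 n)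
∣⋃⁅xs⁆∣≤length     (x ∷ xs) = ℕ.≤-trans (∣p∪q∣≤∣p∣+∣q∣ ⁅ x ⁆ (⋃ (map ⁅_⁆ xs)))
  (subst (λ c → c + _ ≤ suc (length xs)) (sym (∣⁅x⁆∣≡1 x)) (s≤s (∣⋃⁅xs⁆∣≤length xs)))

∈⇒∈⋃⁅xs⁆ : ∀ {n} {x : Fin n} {xs} → x ∈ xs → x ∈ₛ ⋃ (map ⁅_⁆ xs)
∈⇒∈⋃⁅xs⁆ {xs = y ∷ ys} (here refl) = p⊆p∪q (⋃ (map ⁅_⁆ ys)) (x∈⁅x⁆ y)
∈⇒∈⋃⁅xs⁆ {xs = y ∷ ys} (there x∈ys) = q⊆p∪q ⁅ y ⁆ (⋃ (map ⁅_⁆ ys)) (∈⇒∈⋃⁅xs⁆ x∈ys)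

runEnds : ∀ {n} → LineSet n → Subset n
runEnds S = Vec.tabulate (runEnd S)

∈runEnds⇔ : ∀ {n} (S : LineSet n) {a} → a ∈ₛ runEnds S ⇔ runEnd S a ≡ true
∈runEnds⇔ S {a} = mk⇔ (λ a∈ → trans (sym (lookup∘tabulate (runEnd S) a)) ([]=⇒lookup a∈))
                      (λ end → lookup⇒[]= a (runEnds S) (trans (lookup∘tabulate (runEnd S) a) end))

∣runEnds∣≤#intervals : ∀ {n} (S : LineSet n) Is → IsUnionOf S Is → ∣ runEnds S ∣ ≤ length Is
∣runEnds∣≤#intervals S Is S≡⋃Is = begin
  ∣ runEnds S ∣                            ≤⟨ p⊆q⇒∣p∣≤∣q∣ runEnds⊆⋃hi ⟩
  ∣ ⋃ (map ⁅_⁆ (map Interval.hi Is)) ∣     ≤⟨ ∣⋃⁅xs⁆∣≤length (map Interval.hi Is) ⟩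
  length (map Interval.hi Is)              ≡⟨ length-map Interval.hi Is ⟩
  length Is                                ∎
  where
  open ℕ.≤-Reasoning
  runEnds⊆⋃hi : runEnds S ⊆ ⋃ (map ⁅_⁆ (map Interval.hi Is))
  runEnds⊆⋃hi a∈ = ∈⇒∈⋃⁅xs⁆ (runEnd∈map-hi S Is S≡⋃Is (to (∈runEnds⇔ S) a∈))

∣runEnds∣>0 : ∀ {n} (S : LineSet n) → NonEmpty S → 0 < ∣ runEnds S ∣
∣runEnds∣>0 S (i , Si) with a , end ← runEnd-exists S i Si =
  ℕ.≤-<-trans z≤n (x∈p⇒∣p-x∣<∣p∣ (from (∈runEnds⇔ S) end))

-- Cubes and the functional Φ

pad : ∀ {n} d → Fin n → List (Fin n) → Point n d
pad zero    a _        = []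
pad (suc d) a []       = a ∷ pad d a []
pad (suc d) a (x ∷ xs) = x ∷ pad d a xs

toPoint : ∀ {n} d → Monomial n → Point n d
toPoint d (a ∷ xs) = pad d a (a ∷ xs)

cube : ∀ {n d} → LineSet n → GridSet n d
cube S []      = true
cube S (i ∷ x) = S i ∧ cube S x

module _ {n : ℕ} (S : LineSet n) where

  cube-pad : ∀ d {a} xs → S a ≡ true → length xs ≤ d → cube S (pad d a xs) ≡ all S xs
  cube-pad zero    []       Sa _          = refl
  cube-pad (suc d) []       Sa _          = cong₂ _∧_ Sa (cube-pad d [] Sa z≤n)
  cube-pad (suc d) (x ∷ xs) Sa (s≤s ∣xs∣≤d) = cong (S x ∧_) (cube-pad d xs Sa ∣xs∣≤d)

  cube-toPoint : ∀ d (m : Monomial n) → List⁺.length m ≤ d → cube S (toPoint d m) ≡ evalMon S m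
  cube-toPoint (suc d) (a ∷ xs) (s≤s ∣xs∣≤d) with S a in Sa
  ... | false = refl
  ... | true  = cube-pad d xs Sa ∣xs∣≤d

  cube⇔All : ∀ {d} (x : Point n d) → cube S x ≡ true ⇔ VAll.All (λ i → S i ≡ true) x
  cube⇔All []      = mk⇔ (λ _ → []ᵛ) (λ _ → refl)
  cube⇔All (i ∷ x) = mk⇔
    (λ Si∧x → ∧-conicalˡ (S i) _ Si∧x ∷ᵛ to (cube⇔All x) (∧-conicalʳ (S i) _ Si∧x))
    (λ { (Si ∷ᵛ x⊆S) → cong₂ _∧_ Si (from (cube⇔All x) x⊆S) })

SymDiffIsCube⇒≐cube : ∀ {n d} (A B : GridSet n d) {S} → SymDiffIsCube A B S → (A Δ B) ≐ cube S
SymDiffIsCube⇒≐cube A B {S} AΔB≡S^d x = ≡true⇔⇒≡ (⇔.trans (AΔB≡S^d x) (⇔.sym (cube⇔All S x)))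

cube-⊤ : ∀ {n d} (x : Point n d) → cube (λ _ → true) x ≡ true
cube-⊤ x = from (cube⇔All (λ _ → true) x) (VAll.universal (λ _ → refl) x)

runDetector : ∀ n → ℕ → Poly n
runDetector n k = σ≤ _++_ _·_ [] k (Vec.tabulate runEndPoly)

eval-runDetector : ∀ {n} (S : LineSet n) k → NonEmpty S → UnionOfAtMost k S →
                   eval S (runDetector n k) ≡ true
eval-runDetector S k S≢∅ (Is , #Is≤k , S≡⋃Is) = begin
  eval S (σ≤ _++_ _·_ [] k (Vec.tabulate runEndPoly))
    ≡⟨ σ≤-homomorphic (eval S) refl (eval-++ S) (eval-· S) k (Vec.tabulate runEndPoly) ⟩
  σᴮ k (Vec.map (eval S) (Vec.tabulate runEndPoly))
    ≡⟨ cong (σᴮ k) (trans (sym (tabulate-∘ (eval S) runEndPoly)) (tabulate-cong (eval-runEndPoly S))) ⟩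
  σᴮ k (runEnds S)
    ≡⟨ σᴮ-indicator k (runEnds S) (ℕ.≤-trans (∣runEnds∣≤#intervals S Is S≡⋃Is) #Is≤k) ⟩
  0 <ᵇ ∣ runEnds S ∣
    ≡⟨ to T-≡ (ℕ.<⇒<ᵇ (∣runEnds∣>0 S S≢∅)) ⟩
  true ∎
  where open ≡-Reasoning

Φ : ∀ {n} d → GridSet n d → Bool
Φ {n} d X = parity (runDetector n (d / 2)) (X ∘ toPoint d)

Φ-Δ : ∀ {n} d (A B : GridSet n d) → Φ d (A Δ B) ≡ Φ d A xor Φ d B
Φ-Δ {n} d A B = parity-xor (runDetector n (d / 2)) (A ∘ toPoint d) (B ∘ toPoint d)

Φ-cube : ∀ {n} d (S : LineSet n) (X : GridSet n d) → X ≐ cube S →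
         NonEmpty S → UnionOfAtMost (d / 2) S → Φ d X ≡ true
Φ-cube d S X X≐S^d S≢∅ S-runs = trans
  (parity-cong (All.map (λ {m} deg≤d → trans (X≐S^d (toPoint d m)) (cube-toPoint S d m deg≤d))
               (All.map (λ deg≤2k → ℕ.≤-trans deg≤2k (m/n*n≤m d 2))
                        (σ≤-degree 2 (d / 2) _ (tabulate⁺ runEndPoly-degree)))))
  (eval-runDetector S (d / 2) S≢∅ S-runs)

Φ-⊤ : ∀ m d → 2 ≤ d → Φ {suc m} d (λ _ → true) ≡ true
Φ-⊤ m d 2≤d = Φ-cube d (λ _ → true) (λ _ → true) (λ x → sym (cube-⊤ x)) (zero , refl)
  (interval zero (fromℕ m) z≤n ∷ [] , /-monoˡ-≤ 2 2≤d , [n]≡[0,n-1])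
  where
  [n]≡[0,n-1] : IsUnionOf (λ _ → true) (interval zero (fromℕ m) z≤n ∷ [])
  [n]≡[0,n-1] i = mk⇔ (λ _ → here (z≤n , Fin.≤fromℕ i)) (λ _ → refl)

Φ≡0⇒¬SymDiffIsCube : ∀ {n} d (A B : GridSet n d) {S} → Φ d A ≡ false → Φ d B ≡ false →
  NonEmpty S → UnionOfAtMost (d / 2) S → ¬ SymDiffIsCube A B S
Φ≡0⇒¬SymDiffIsCube d A B {S} ΦA≡0 ΦB≡0 S≢∅ S-runs AΔB≡S^d = false≢true (begin
  false            ≡⟨ cong₂ _xor_ ΦA≡0 ΦB≡0 ⟨
  Φ d A xor Φ d B  ≡⟨ Φ-Δ d A B ⟨
  Φ d (A Δ B)      ≡⟨ Φ-cube d S (A Δ B) (SymDiffIsCube⇒≐cube A B AΔB≡S^d) S≢∅ S-runs ⟩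
  true             ∎)
  where open ≡-Reasoning

-- Enumerating the kernel of a linear functional

module _ {A : Set} (_≟_ : DecidableEquality A) where

  update : A → Bool → (A → Bool) → A → Bool
  update a v f x = if does (x ≟ a) then v else f x

  update-same : ∀ a v f → update a v f a ≡ v
  update-same a v f with a ≟ a
  ... | yes _   = refl
  ... | no  a≢a = contradiction refl a≢a

  update-other : ∀ {a x} v f → x ≢ a → update a v f x ≡ f x
  update-other {a} {x} v f x≢a with x ≟ a
  ... | yes x≡a = contradiction x≡a x≢a
  ... | no  _   = refl

  subsets : List A → List (A → Bool)
  subsets []       = (λ _ → false) ∷ []
  subsets (a ∷ as) = map (update a false) (subsets as) ++ map (update a true) (subsets as)

  length-subsets : ∀ as → length (subsets as) ≡ 2 ^ length as
  length-subsets []       = refl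
  length-subsets (a ∷ as) = begin
    length (map (update a false) (subsets as) ++ map (update a true) (subsets as))
      ≡⟨ length-++ (map (update a false) (subsets as)) ⟩
    length (map (update a false) (subsets as)) + length (map (update a true) (subsets as))
      ≡⟨ cong₂ _+_ (length-map (update a false) (subsets as)) (length-map (update a true) (subsets as)) ⟩
    length (subsets as) + length (subsets as)
      ≡⟨ cong (λ l → l + l) (length-subsets as) ⟩
    2 ^ length as + 2 ^ length as
      ≡⟨ cong (2 ^ length as +_) (sym (ℕ.+-identityʳ (2 ^ length as))) ⟩
    2 ^ length (a ∷ as) ∎
    where open ≡-Reasoning

  DifferOn : List A → (A → Bool) → (A → Bool) → Set
  DifferOn as f g = ∃ λ x → x ∈ as × f x ≢ g x

  subsets-differ : ∀ {as} → Unique as → AllPairs (DifferOn as) (subsets as)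
  subsets-differ {[]}     []           = [] ∷ []
  subsets-differ {a ∷ as} (a∉as ∷ !as) =
    AllPairs.++⁺ (AllPairs.map⁺ (AllPairs.map (update-differ false) ih))
                 (AllPairs.map⁺ (AllPairs.map (update-differ true) ih))
                 (All.map⁺ (All.universal (λ f → All.map⁺ (All.universal (λ g → differ-at-a f g) _)) _))
    where
    ih = subsets-differ !as
    update-differ : ∀ v {f g} → DifferOn as f g → DifferOn (a ∷ as) (update a v f) (update a v g)
    update-differ v {f} {g} (x , x∈as , fx≢gx) = x , there x∈as , λ eq →
      fx≢gx (trans (sym (update-other v f x≢a)) (trans eq (update-other v g x≢a)))
      where
      x≢a : x ≢ a
      x≢a refl = All.lookup a∉as x∈as refl
    differ-at-a : ∀ f g → DifferOn (a ∷ as) (update a false f) (update a true g)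
    differ-at-a f g = a , here refl , λ eq → false≢true
      (trans (sym (update-same a false f)) (trans eq (update-same a true g)))

length-cartesianProductWith : ∀ {A B C : Set} (f : A → B → C) xs ys →
  length (cartesianProductWith f xs ys) ≡ length xs * length ys
length-cartesianProductWith f []       ys = refl
length-cartesianProductWith f (x ∷ xs) ys = begin
  length (map (f x) ys ++ cartesianProductWith f xs ys)
    ≡⟨ length-++ (map (f x) ys) ⟩
  length (map (f x) ys) + length (cartesianProductWith f xs ys)
    ≡⟨ cong₂ _+_ (length-map (f x) ys) (length-cartesianProductWith f xs ys) ⟩
  length ys + length xs * length ys ∎
  where open ≡-Reasoning

vectors : ∀ {A : Set} → List A → ∀ d → List (Vec A d)
vectors xs zero    = [] ∷ []
vectors xs (suc d) = cartesianProductWith _∷_ xs (vectors xs d)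

length-vectors : ∀ {A : Set} (xs : List A) d → length (vectors xs d) ≡ length xs ^ d
length-vectors xs zero    = refl
length-vectors xs (suc d) = trans (length-cartesianProductWith _∷_ xs (vectors xs d))
                                  (cong (length xs *_) (length-vectors xs d))

vectors-unique : ∀ {A : Set} {xs : List A} d → Unique xs → Unique (vectors xs d)
vectors-unique zero    !xs = [] ∷ []
vectors-unique (suc d) !xs = Unique.cartesianProductWith⁺ _∷_ ∷-injective !xs (vectors-unique d !xs)

grid-enumeration : ∀ n d → Σ (List (Point n d)) λ ps → Unique ps × length ps ≡ n ^ d
grid-enumeration n d = vectors (allFin n) d , vectors-unique d (Unique.allFin⁺ n) ,
  trans (length-vectors (allFin n) d) (cong (_^ d) (length-tabulate id))

module _ {n d : ℕ} (φ : GridSet n d → Bool) (φ-Δ : ∀ A B → φ (A Δ B) ≡ φ A xor φ B) where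

  project : GridSet n d → GridSet n d
  project X = if φ X then X Δ (λ _ → true) else X

  φ-project : φ (λ _ → true) ≡ true → ∀ X → φ (project X) ≡ false
  φ-project φ⊤ X with φ X in φX
  ... | false = φX
  ... | true  = trans (φ-Δ X (λ _ → true)) (cong₂ _xor_ φX φ⊤)

  project-injective : ∀ {X Y p} → X p ≡ Y p → project X ≐ project Y → X ≐ Y
  project-injective {X} {Y} {p} Xp≡Yp πX≐πY x with φ X | φ Y
  ... | false | false = πX≐πY x
  ... | true  | true  = not-injective (trans (sym (xor-true (X x))) (trans (πX≐πY x) (xor-true (Y x))))
  ... | true  | false = contradiction (trans (πX≐πY p) (sym Xp≡Yp)) (xor-true≢id (X p))
  ... | false | true  = contradiction (trans (sym (πX≐πY p)) Xp≡Yp) (xor-true≢id (Y p))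

  -- project is injective on the sets not containing p, and these are the subsets of the other points.
  enumerateKernel : φ (λ _ → true) ≡ true → (ps : List (Point n d)) → Unique ps → 0 < length ps →
    Σ (List (GridSet n d)) λ 𝒜 →
      DistinctList 𝒜 × length 𝒜 ≡ 2 ^ (length ps ∸ 1) × All (λ A → φ A ≡ false) 𝒜
  enumerateKernel φ⊤ (p ∷ ps) (p∉ps ∷ !ps) _ = map π (subsets _≟ₚ_ ps) , distinct , size , inKernel
    where
    _≟ₚ_ : DecidableEquality (Point n d)
    _≟ₚ_ = Vec.≡-dec Fin._≟_
    π : GridSet n d → GridSet n d
    π X = project (update _≟ₚ_ p false X)
    distinct : DistinctList (map π (subsets _≟ₚ_ ps))
    distinct = AllPairs.map⁺ (AllPairs.map π-distinct (subsets-differ _≟ₚ_ !ps))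
      where
      π-distinct : ∀ {X Y} → DifferOn _≟ₚ_ ps X Y → ¬ (π X ≐ π Y)
      π-distinct {X} {Y} (x , x∈ps , Xx≢Yx) πX≐πY = Xx≢Yx (begin
        X x                      ≡⟨ update-other _≟ₚ_ false X x≢p ⟨
        update _≟ₚ_ p false X x  ≡⟨ project-injective p∉X∪Y πX≐πY x ⟩
        update _≟ₚ_ p false Y x  ≡⟨ update-other _≟ₚ_ false Y x≢p ⟩
        Y x                      ∎)
        where
        open ≡-Reasoning
        p∉X∪Y : update _≟ₚ_ p false X p ≡ update _≟ₚ_ p false Y p
        p∉X∪Y = trans (update-same _≟ₚ_ p false X) (sym (update-same _≟ₚ_ p false Y))
        x≢p : x ≢ p
        x≢p refl = All.lookup p∉ps x∈ps refl
    size : length (map π (subsets _≟ₚ_ ps)) ≡ 2 ^ length ps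
    size = trans (length-map π (subsets _≟ₚ_ ps)) (length-subsets _≟ₚ_ ps)
    inKernel : All (λ A → φ A ≡ false) (map π (subsets _≟ₚ_ ps))
    inKernel = All.map⁺ (All.universal (φ-project φ⊤ ∘ update _≟ₚ_ p false) _)

theorem1p3 : (n d : ℕ) → 2 ≤ d → d ≤ n →
    Σ (List (GridSet n d)) λ 𝒜 →
      DistinctList 𝒜 × (length 𝒜 ≡ 2 ^ (n ^ d ∸ 1)) ×
      (∀ A B S → A ∈ 𝒜 → B ∈ 𝒜 → NonEmpty S → UnionOfAtMost (d / 2) S →
        ¬ SymDiffIsCube A B S)
theorem1p3 zero    d (s≤s (s≤s _)) ()
theorem1p3 (suc m) d 2≤d _ =
  let ps , !ps , #ps           = grid-enumeration (suc m) d
      𝒜 , distinct , size , Φ≡0 = enumerateKernel (Φ d) (Φ-Δ d) (Φ-⊤ m d 2≤d) ps !ps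
                                    (subst (0 <_) (sym #ps) (ℕ.m^n>0 (suc m) d))
  in  𝒜 , distinct , trans size (cong (λ N → 2 ^ (N ∸ 1)) #ps) ,
      λ A B S A∈𝒜 B∈𝒜 → Φ≡0⇒¬SymDiffIsCube d A B (All.lookup Φ≡0 A∈𝒜) (All.lookup Φ≡0 B∈𝒜)
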